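{- Let $M\equiv\mu\alpha.\mathsf{car}_n(\beta)\star\pi$ and $N\equiv\mu\alpha.\mathsf{car}_{n'}(\beta')\star\pi'$ be terms of the extended stack calculus (with stack variables $\alpha,\beta,\beta'$, natural numbers $n,n'$ and stacks $\pi,\pi'$). If $M\not\sim N$, then $M$ and $N$ are separable.
   Context: The extended stack calculus. Stack variables $\alpha,\beta,\gamma,\ldots$. Stacks $\pi ::= \mathsf{nil}\mid\alpha\mid\mathsf{cdr}(\pi)\mid M::\pi$; terms $M ::= \mathsf{car}(\pi)\mid\mu\alpha.M\mid M\star\pi$ ($\star$ left-associative, precedence over $\mu$; $::$ right-associative, binding tighter than $\star$; $\mu\alpha_1\ldots\alpha_k.M\star\pi_1\star\cdots\star\pi_m$ abbreviates $\mu\alpha_1\ldots\mu\alpha_k.(M\star\pi_1\star\cdots\star\pi_m)$). $E\{\pi/\alpha\}$ is capture-avoiding substitution. Reductions: $(\mu\alpha.M)\star\pi\to M\{\pi/\alpha\}$, $\mathsf{car}(M::\pi)\to M$, $\mathsf{cdr}(M::\pi)\to\pi$; $=_s$ is the equivalence closure of their contextual closure. $\mathsf{cdr}^n$ is $n$-fold $\mathsf{cdr}$; $\mathsf{car}_n(\pi):=\mathsf{car}(\mathsf{cdr}^n(\pi))$. Canonical form: normal form w.r.t. the $\mathsf{car},\mathsf{cdr}$ rules. Head reduction: $M\to_h\mu\vec\alpha.N\{\varpi/\beta\}\star\vec\pi$ if $\mu\vec\alpha.(\mu\beta.N)\star\varpi\star\vec\pi$ is the canonical form of $M$ (no contextual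 closure). A hnf is a non-$\to_h$-reducible term $\mu\vec\alpha.H\star\vec\pi$, proper if $H=\mathsf{car}_n(\beta)$ and improper if $H=\mathsf{car}_n(\mathsf{nil})$; $\mathrm{hnf}(M)$ is the hnf reached from $M$ by $\to_h$, if it exists (partial function). Head contexts: $C[\cdot]::=[\cdot]\mid C[\cdot]\star\pi\mid\mu\alpha.C[\cdot]$. $\mathbf T:=\mu\alpha.\mathsf{car}_0(\alpha)\star\mathsf{cdr}^2(\alpha)$, $\mathbf F:=\mu\alpha.\mathsf{car}_1(\alpha)\star\mathsf{cdr}^2(\alpha)$; $M,N$ are separable if some head context $C$ has $C[M]=_s\mathbf T$ and $C[N]=_s\mathbf F$. Similarity of stacks $\sim_s$: the smallest equivalence relation on stacks containing $=_s$ such that (1) $\pi\sim_s M_1::\cdots::M_m::\mathsf{cdr}^k(\mathsf{nil})$ for every stack $\pi$, terms $M_i$ and $m,k\ge0$; (2) if $k-m=k'-m'$ then $M_1::\cdots::M_m::\mathsf{cdr}^k(\gamma)\sim_s N_1::\cdots::N_{m'}::\mathsf{cdr}^{k'}(\gamma)$. Similarity of terms $\sim$: the smallest equivalence relation on terms containing $=_s$ such that (1) if $k-m=k'-m'$, $\pi_i\sim_s\varpi_i$ for all $i=1,\ldots,\min\{m,m'\}$, and $\varpi_{\min\{m,m'\}+j}\sim_s\alpha_{\min\{k,k'\}+j}$ for all $j=1,\ldots,\max\{k,k'\}-\min\{k,k'\}$, then $\mu\alpha_1\ldots\alpha_k.\mathsf{car}_n(\beta)\star\pi_1\star\cdots\star\pi_m\sim\mu\alpha_1\ldots\alpha_{k'}.\mathsf{car}_n(\beta)\star\varpi_1\star\cdots\star\varpi_{m'}$;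 (2) if $\mathrm{hnf}(M)$ and $\mathrm{hnf}(N)$ are both defined and improper then $M\sim N$; (3) if $\mathrm{hnf}(M)$ and $\mathrm{hnf}(N)$ are both undefined then $M\sim N$. -}

module Defs where

open import Data.Nat using (ℕ; zero; suc; _+_)
open import Data.List using (List; []; _∷_; _++_; foldl; foldr; map; downFrom; length)
open import Data.List.Relation.Binary.Pointwise using (Pointwise)
open import Data.Product using (Σ; ∃; _×_; _,_)
open import Relation.Nullary using (¬_)
open import Relation.Binary.PropositionalEquality using (_≡_)
open import Relation.Binary.Construct.Closure.ReflexiveTransitive using (Star)
open import Relation.Binary.Construct.Closure.Equivalence using (EqClosure)

-- Syntax of the extended stack calculus, with de Bruijn indices for
-- stack variables (var x).  μ binds one stack variable (index 0).

infixr 6 _∷ₛ_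
infixl 5 _⋆_
infix 8 _[_]
infix 3 _⟶ₜ_ _⟶ₛ_ _=ₜ_ _=ₛ_ _↦spine_ _↦head_ _→h_ _∼ₛ_ _∼_

mutual
  data Stack : Set where
    nil  : Stack
    var  : ℕ → Stack
    cdr  : Stack → Stack
    _∷ₛ_ : Term → Stack → Stack

  data Term : Set where
    car : Stack → Term
    μ   : Term → Term
    _⋆_ : Term → Stack → Term

ext : (ℕ → ℕ) → ℕ → ℕ
ext ρ zero    = zero
ext ρ (suc x) = suc (ρ x)

mutual
  renS : (ℕ → ℕ) → Stack → Stack
  renS ρ nil      = nil
  renS ρ (var x)  = var (ρ x)
  renS ρ (cdr π)  = cdr (renS ρ π)
  renS ρ (M ∷ₛ π) = renT ρ M ∷ₛ renS ρ π

  renT : (ℕ → ℕ) → Term → Term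
  renT ρ (car π) = car (renS ρ π)
  renT ρ (μ M)   = μ (renT (ext ρ) M)
  renT ρ (M ⋆ π) = renT ρ M ⋆ renS ρ π

exts : (ℕ → Stack) → ℕ → Stack
exts σ zero    = var zero
exts σ (suc x) = renS suc (σ x)

mutual
  subS : (ℕ → Stack) → Stack → Stack
  subS σ nil      = nil
  subS σ (var x)  = σ x
  subS σ (cdr π)  = cdr (subS σ π)
  subS σ (M ∷ₛ π) = subT σ M ∷ₛ subS σ π

  subT : (ℕ → Stack) → Term → Term
  subT σ (car π) = car (subS σ π)
  subT σ (μ M)   = μ (subT (exts σ) M)
  subT σ (M ⋆ π) = subT σ M ⋆ subS σ π

-- single substitution M{ϖ/β} where β is the variable bound by the μ
single : Stack → ℕ → Stack
single ϖ zero    = ϖ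
single ϖ (suc x) = var x

_[_] : Term → Stack → Term
M [ ϖ ] = subT (single ϖ) M

wkS : ℕ → Stack → Stack
wkS d = renS (d +_)

cdr^ : ℕ → Stack → Stack
cdr^ zero    π = π
cdr^ (suc n) π = cdr (cdr^ n π)

carₙ : ℕ → Stack → Term
carₙ n π = car (cdr^ n π)

mus : ℕ → Term → Term
mus zero    M = M
mus (suc k) M = μ (mus k M)

_⋆⋆_ : Term → List Stack → Term
M ⋆⋆ πs = foldl _⋆_ M πs

_++ₛ_ : List Term → Stack → Stack
Ms ++ₛ π = foldr _∷ₛ_ π Ms

𝐓 : Term
𝐓 = μ (carₙ 0 (var 0) ⋆ cdr^ 2 (var 0))

𝐅 : Term
𝐅 = μ (carₙ 1 (var 0) ⋆ cdr^ 2 (var 0))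

mutual
  data _⟶ₜ_ : Term → Term → Set where
    μ-β   : ∀ {M π} → (μ M) ⋆ π ⟶ₜ M [ π ]
    car-β : ∀ {M π} → car (M ∷ₛ π) ⟶ₜ M
    car-c : ∀ {π π'} → π ⟶ₛ π' → car π ⟶ₜ car π'
    μ-c   : ∀ {M M'} → M ⟶ₜ M' → μ M ⟶ₜ μ M'
    ⋆-l   : ∀ {M M' π} → M ⟶ₜ M' → M ⋆ π ⟶ₜ M' ⋆ π
    ⋆-r   : ∀ {M π π'} → π ⟶ₛ π' → M ⋆ π ⟶ₜ M ⋆ π'

  data _⟶ₛ_ : Stack → Stack → Set where
    cdr-β : ∀ {M π} → cdr (M ∷ₛ π) ⟶ₛ π
    cdr-c : ∀ {π π'} → π ⟶ₛ π' → cdr π ⟶ₛ cdr π'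
    ∷-l   : ∀ {M M' π} → M ⟶ₜ M' → M ∷ₛ π ⟶ₛ M' ∷ₛ π
    ∷-r   : ∀ {M π π'} → π ⟶ₛ π' → M ∷ₛ π ⟶ₛ M ∷ₛ π'

_=ₜ_ : Term → Term → Set
_=ₜ_ = EqClosure _⟶ₜ_

_=ₛ_ : Stack → Stack → Set
_=ₛ_ = EqClosure _⟶ₛ_

car′ : Stack → Term
car′ (M ∷ₛ π) = M
car′ π        = car π

cdr′ : Stack → Stack
cdr′ (M ∷ₛ π) = π
cdr′ π        = cdr π

mutual
  canonS : Stack → Stack
  canonS nil      = nil
  canonS (var x)  = var x
  canonS (cdr π)  = cdr′ (canonS π)
  canonS (M ∷ₛ π) = canonT M ∷ₛ canonS π

  canonT : Term → Term
  canonT (car π) = car′ (canonS π)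
  canonT (μ M)   = μ (canonT M)
  canonT (M ⋆ π) = canonT M ⋆ canonS π

-- Head reduction:  M →h μα⃗.N{ϖ/β} ⋆ π⃗  when the canonical form of M
-- is  μα⃗.(μβ.N) ⋆ ϖ ⋆ π⃗  (no contextual closure)

data _↦spine_ : Term → Term → Set where
  redex : ∀ {N ϖ} → (μ N) ⋆ ϖ ↦spine N [ ϖ ]
  app   : ∀ {M M' π} → M ↦spine M' → M ⋆ π ↦spine M' ⋆ π

data _↦head_ : Term → Term → Set where
  body  : ∀ {M M'} → M ↦spine M' → M ↦head M'
  under : ∀ {M M'} → M ↦head M' → μ M ↦head μ M'

_→h_ : Term → Term → Set
M →h M' = canonT M ↦head M'

HeadNormal : Term → Set
HeadNormal H = ¬ (∃ λ H' → H →h H')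

IsHnfOf : Term → Term → Set
IsHnfOf H M = Star _→h_ M H × HeadNormal H

HasHnf : Term → Set
HasHnf M = ∃ λ H → IsHnfOf H M

Improper : Term → Set
Improper H = Σ ℕ λ k → Σ ℕ λ n → Σ (List Stack) λ πs →
  canonT H ≡ mus k (carₙ n nil ⋆⋆ πs)

HasImproperHnf : Term → Set
HasImproperHnf M = ∃ λ H → IsHnfOf H M × Improper H

data StackSimGen : Stack → Stack → Set where
  conv   : ∀ {π ρ} → π =ₛ ρ → StackSimGen π ρ
  nilCdr : ∀ π (Ms : List Term) k → StackSimGen π (Ms ++ₛ cdr^ k nil)
  varCdr : ∀ (Ms Ns : List Term) k k' γ →
           k + length Ns ≡ k' + length Ms →      -- k − m = k' − m'
           StackSimGen (Ms ++ₛ cdr^ k (var γ)) (Ns ++ₛ cdr^ k' (var γ))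

_∼ₛ_ : Stack → Stack → Set
_∼ₛ_ = EqClosure StackSimGen

-- Clause (1) is stated for k ≤ k' (k' = k + d);
-- the case k' ≤ k is its symmetric instance.  Under k' = k + d binders,
-- α_{k+j} is the de Bruijn index d − j, the stacks π_i (under k binders)
-- are weakened by d, and the same variable β has index b + d.

data SimGen : Term → Term → Set where
  conv     : ∀ {M N} → M =ₜ N → SimGen M N
  headVar  : ∀ k d n b (πs ϖs es : List Stack) →
             Pointwise (λ π ϖ → wkS d π ∼ₛ ϖ) πs ϖs →
             Pointwise _∼ₛ_ es (map var (downFrom d)) →
             SimGen (mus k (carₙ n (var b) ⋆⋆ πs))
                    (mus (k + d) (carₙ n (var (b + d)) ⋆⋆ (ϖs ++ es)))
  improper : ∀ {M N} → HasImproperHnf M → HasImproperHnf N → SimGen M N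
  noHnf    : ∀ {M N} → ¬ HasHnf M → ¬ HasHnf N → SimGen M N

_∼_ : Term → Term → Set
_∼_ = EqClosure SimGen

data HCtx : Set where
  hole : HCtx
  _⋆c_ : HCtx → Stack → HCtx
  μc   : HCtx → HCtx

-- plugging (not capture-avoiding: binders of the context may capture)
plug : HCtx → Term → Term
plug hole     M = M
plug (C ⋆c π) M = plug C M ⋆ π
plug (μc C)   M = μ (plug C M)

Separable : Term → Term → Set
Separable M N = ∃ λ C → (plug C M =ₜ 𝐓) × (plug C N =ₜ 𝐅)

-- A head context  μ^L[·] ⋆ T_L ⋆ ⋯ ⋆ T_0  instantiates every stack
-- variable x ≤ L of the plugged term (the term's own α included) by a
-- closed "table" stack  T_x = g x 0 :: g x 1 :: ⋯ :: g x (K-1) :: nil.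
-- After this, the head  carₙ(β)  becomes the table entry  g β n,  which is
-- chosen to be a selector:
--  * if the heads (β, n) and (β', n') differ, the entries at these two
--    positions are  μ_.𝐓  and  μ_.𝐅,  which ignore their argument;
--  * if the heads agree, the entry is a reader  μδ.carⱼ(δ) ⋆ nil  which
--    looks past the prefix of the argument stack into the table of the
--    variable γ at its end.  Writing the stacks as spines
--    M₁ :: ⋯ :: M_m :: cdr^k(tail), a nil tail, or equal variable tails
--    with k − m = k' − m', make the terms similar; otherwise the reader
--    lands on two different table positions, holding  μ_.𝐓  and  μ_.𝐅.

module Submission where

open import Defs
open import Data.Nat using (ℕ; zero; suc; _+_; _<_; s≤s; s≤s⁻¹; _≟_)
open import Data.Nat.Properties
  using (+-assoc; +-comm; +-identityʳ; +-cancelˡ-≡; m≤m+n; m≤n+m; ≤-trans; <-trans; >⇒≢; m≤n⇒m<n∨m≡n)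
open import Data.List using (List; []; _∷_; map; length; downFrom)
open import Data.List.Properties using (length-map)
open import Data.List.Relation.Binary.Pointwise using ([]; _∷_)
open import Data.Product using (_×_; _,_; proj₁; proj₂)
open import Data.Sum using (inj₁; inj₂)
open import Data.Empty using (⊥-elim)
open import Function using (_∘_)
open import Relation.Nullary using (¬_; yes; no)
open import Relation.Nullary.Decidable using (_×-dec_)
open import Relation.Binary.PropositionalEquality hiding ([_])
open import Relation.Binary.Construct.Closure.ReflexiveTransitive using (Star; ε; _◅_; _◅◅_; gmap)
open import Relation.Binary.Construct.Closure.ReflexiveTransitive.Properties using (module StarReasoning)
open import Relation.Binary.Construct.Closure.Symmetric using (fwd)
open import Relation.Binary.Construct.Closure.Equivalence using (symmetric; return)

infix 3 _⟶*_ _⟶ₛ*_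

_⟶*_ : Term → Term → Set
_⟶*_ = Star _⟶ₜ_

_⟶ₛ*_ : Stack → Stack → Set
_⟶ₛ*_ = Star _⟶ₛ_

⟶*⇒=ₜ : ∀ {M N} → M ⟶* N → M =ₜ N
⟶*⇒=ₜ = gmap (λ M → M) fwd

⟶ₛ*⇒=ₛ : ∀ {π ρ} → π ⟶ₛ* ρ → π =ₛ ρ
⟶ₛ*⇒=ₛ = gmap (λ π → π) fwd

cdr^-suc : ∀ p s → cdr^ (suc p) s ≡ cdr^ p (cdr s)
cdr^-suc zero    s = refl
cdr^-suc (suc p) s = cong cdr (cdr^-suc p s)

cdr^-+ : ∀ r m s → cdr^ (r + m) s ≡ cdr^ r (cdr^ m s)
cdr^-+ zero    m s = refl
cdr^-+ (suc r) m s = cong cdr (cdr^-+ r m s)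

cdr^-⟶ : ∀ p {s s'} → s ⟶ₛ s' → cdr^ p s ⟶ₛ cdr^ p s'
cdr^-⟶ zero    st = st
cdr^-⟶ (suc p) st = cdr-c (cdr^-⟶ p st)

cdr^-sub : ∀ σ p s → subS σ (cdr^ p s) ≡ cdr^ p (subS σ s)
cdr^-sub σ zero    s = refl
cdr^-sub σ (suc p) s = cong cdr (cdr^-sub σ p s)

cdr^-ren : ∀ ρ p s → renS ρ (cdr^ p s) ≡ cdr^ p (renS ρ s)
cdr^-ren ρ zero    s = refl
cdr^-ren ρ (suc p) s = cong cdr (cdr^-ren ρ p s)

drop-prefix : ∀ Ms X → cdr^ (length Ms) (Ms ++ₛ X) ⟶ₛ* X
drop-prefix []       X = ε
drop-prefix (M ∷ Ms) X rewrite cdr^-suc (length Ms) (M ∷ₛ (Ms ++ₛ X)) =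
  cdr^-⟶ (length Ms) cdr-β ◅ drop-prefix Ms X

data Tail : Set where
  nil-tail : Tail
  var-tail : ℕ → Tail

tailStack : Tail → Stack
tailStack nil-tail     = nil
tailStack (var-tail γ) = var γ

record SpineForm (π : Stack) : Set where
  constructor spine
  field
    prefix  : List Term
    depth   : ℕ
    tail    : Tail
    reduces : π ⟶ₛ* prefix ++ₛ cdr^ depth (tailStack tail)

spineForm : ∀ π → SpineForm π
spineForm nil      = spine [] 0 nil-tail ε
spineForm (var γ)  = spine [] 0 (var-tail γ) ε
spineForm (M ∷ₛ π) with spineForm π
... | spine Ms k t red = spine (M ∷ Ms) k t (gmap (M ∷ₛ_) ∷-r red)
spineForm (cdr π) with spineForm π
... | spine []       k t red = spine [] (suc k) t (gmap cdr cdr-c red)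
... | spine (M ∷ Ms) k t red = spine Ms k t (gmap cdr cdr-c red ◅◅ cdr-β ◅ ε)

⟶ₛ*⇒∼ₛ : ∀ {π ρ} → π ⟶ₛ* ρ → π ∼ₛ ρ
⟶ₛ*⇒∼ₛ red = return (conv (⟶ₛ*⇒=ₛ red))

nil-spine∼ₛ : ∀ {π Ms k} → π ⟶ₛ* Ms ++ₛ cdr^ k nil → ∀ π' → π ∼ₛ π'
nil-spine∼ₛ {Ms = Ms} {k} red π' =
  ⟶ₛ*⇒∼ₛ red ◅◅ symmetric StackSimGen (return (nilCdr π' Ms k))

var-spine∼ₛ : ∀ {π π' Ms Ns k k' γ} →
  π ⟶ₛ* Ms ++ₛ cdr^ k (var γ) → π' ⟶ₛ* Ns ++ₛ cdr^ k' (var γ) →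
  k + length Ns ≡ k' + length Ms → π ∼ₛ π'
var-spine∼ₛ {Ms = Ms} {Ns} {k} {k'} {γ} red red' balanced =
  ⟶ₛ*⇒∼ₛ red ◅◅ return (varCdr Ms Ns k k' γ balanced) ◅◅ symmetric StackSimGen (⟶ₛ*⇒∼ₛ red')

ext-id : ∀ ρ → (∀ x → ρ x ≡ x) → ∀ x → ext ρ x ≡ x
ext-id ρ ρ-id zero    = refl
ext-id ρ ρ-id (suc x) = cong suc (ρ-id x)

mutual
  renS-id : ∀ ρ → (∀ x → ρ x ≡ x) → ∀ π → renS ρ π ≡ π
  renS-id ρ ρ-id nil      = refl
  renS-id ρ ρ-id (var x)  = cong var (ρ-id x)
  renS-id ρ ρ-id (cdr π)  = cong cdr (renS-id ρ ρ-id π)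
  renS-id ρ ρ-id (M ∷ₛ π) = cong₂ _∷ₛ_ (renT-id ρ ρ-id M) (renS-id ρ ρ-id π)

  renT-id : ∀ ρ → (∀ x → ρ x ≡ x) → ∀ M → renT ρ M ≡ M
  renT-id ρ ρ-id (car π) = cong car (renS-id ρ ρ-id π)
  renT-id ρ ρ-id (μ M)   = cong μ (renT-id (ext ρ) (ext-id ρ ρ-id) M)
  renT-id ρ ρ-id (M ⋆ π) = cong₂ _⋆_ (renT-id ρ ρ-id M) (renS-id ρ ρ-id π)

head∼ : ∀ n b {π π'} → π ∼ₛ π' → μ (carₙ n (var b) ⋆ π) ∼ μ (carₙ n (var b) ⋆ π')
head∼ n b {π} {π'} π∼π' =
  subst (λ c → μ (carₙ n (var b) ⋆ π) ∼ μ (carₙ n (var c) ⋆ π')) (+-identityʳ b)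
    (return (headVar 1 0 n b (π ∷ []) (π' ∷ []) [] (wk0π∼π' ∷ []) []))
  where
  wk0π∼π' : wkS 0 π ∼ₛ π'
  wk0π∼π' = subst (_∼ₛ π') (sym (renS-id (0 +_) (λ _ → refl) π)) π∼π'

ClosedS : Stack → Set
ClosedS s = (∀ σ → subS σ s ≡ s) × (∀ ρ → renS ρ s ≡ s)

ClosedT : Term → Set
ClosedT M = (∀ σ → subT σ M ≡ M) × (∀ ρ → renT ρ M ≡ M)

extsN : ℕ → (ℕ → Stack) → ℕ → Stack
extsN zero    σ = σ
extsN (suc a) σ = extsN a (exts σ)

extsN-suc : ∀ a σ x → extsN (suc a) σ x ≡ exts (extsN a σ) x
extsN-suc zero    σ x = refl
extsN-suc (suc a) σ x = extsN-suc a (exts σ) x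

mus-sub : ∀ a σ P → subT σ (mus a P) ≡ mus a (subT (extsN a σ) P)
mus-sub zero    σ P = refl
mus-sub (suc a) σ P = cong μ (mus-sub a (exts σ) P)

extsN-below : ∀ a σ x → x < a → extsN a σ x ≡ var x
extsN-below (suc a) σ zero    _         = extsN-suc a σ zero
extsN-below (suc a) σ (suc x) (s≤s x<a) =
  trans (extsN-suc a σ (suc x)) (cong (renS suc) (extsN-below a σ x x<a))

extsN-top : ∀ a σ → (∀ ρ → renS ρ (σ 0) ≡ σ 0) → extsN a σ a ≡ σ 0
extsN-top zero    σ closed = refl
extsN-top (suc a) σ closed =
  trans (extsN-suc a σ (suc a)) (trans (cong (renS suc) (extsN-top a σ closed)) (closed suc))

-- Instantiation of the variables 0 … L−1 by f 0 … f (L−1), performed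
-- one binder at a time, outermost (L−1) first, as β-reduction does.

instS : ℕ → (ℕ → Stack) → Stack → Stack
instS zero    f s = s
instS (suc L) f s = instS L f (subS (extsN L (single (f L))) s)

instT : ℕ → (ℕ → Stack) → Term → Term
instT zero    f M = M
instT (suc L) f M = instT L f (subT (extsN L (single (f L))) M)

inst-car : ∀ L f s → instT L f (car s) ≡ car (instS L f s)
inst-car zero    f s = refl
inst-car (suc L) f s = inst-car L f (subS (extsN L (single (f L))) s)

inst-⋆ : ∀ L f M s → instT L f (M ⋆ s) ≡ instT L f M ⋆ instS L f s
inst-⋆ zero    f M s = refl
inst-⋆ (suc L) f M s = inst-⋆ L f (subT σ M) (subS σ s)
  where σ = extsN L (single (f L))

inst-∷ : ∀ L f M s → instS L f (M ∷ₛ s) ≡ instT L f M ∷ₛ instS L f s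
inst-∷ zero    f M s = refl
inst-∷ (suc L) f M s = inst-∷ L f (subT σ M) (subS σ s)
  where σ = extsN L (single (f L))

inst-cdr^ : ∀ L f p s → instS L f (cdr^ p s) ≡ cdr^ p (instS L f s)
inst-cdr^ zero    f p s = refl
inst-cdr^ (suc L) f p s =
  trans (cong (instS L f) (cdr^-sub (extsN L (single (f L))) p s)) (inst-cdr^ L f p _)

inst-++ₛ : ∀ L f Ms s → instS L f (Ms ++ₛ s) ≡ map (instT L f) Ms ++ₛ instS L f s
inst-++ₛ L f []       s = refl
inst-++ₛ L f (M ∷ Ms) s = trans (inst-∷ L f M _) (cong (instT L f M ∷ₛ_) (inst-++ₛ L f Ms s))

inst-closed : ∀ L f {s} → ClosedS s → instS L f s ≡ s
inst-closed zero    f closed = refl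
inst-closed (suc L) f closed =
  trans (cong (instS L f) (proj₁ closed _)) (inst-closed L f closed)

inst-var : ∀ L f → (∀ x → ClosedS (f x)) → ∀ x → x < L → instS L f (var x) ≡ f x
inst-var (suc L) f closed x x<1+L with m≤n⇒m<n∨m≡n (s≤s⁻¹ x<1+L)
... | inj₁ x<L  = trans (cong (instS L f) (extsN-below L (single (f L)) x x<L))
                        (inst-var L f closed x x<L)
... | inj₂ refl = trans (cong (instS L f) (extsN-top L (single (f L)) (proj₂ (closed L))))
                        (inst-closed L f (closed L))

⋆⋆-⟶ : ∀ {X X'} ts → X ⟶ₜ X' → X ⋆⋆ ts ⟶ₜ X' ⋆⋆ ts
⋆⋆-⟶ []       st = st
⋆⋆-⟶ (t ∷ ts) st = ⋆⋆-⟶ ts (⋆-l st)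

apply-μs : ∀ L f P → mus L P ⋆⋆ map f (downFrom L) ⟶* instT L f P
apply-μs zero    f P = ε
apply-μs (suc L) f P =
  ⋆⋆-⟶ (map f (downFrom L)) μ-β ◅
  subst (λ Q → Q ⋆⋆ map f (downFrom L) ⟶* instT (suc L) f P)
        (sym (mus-sub L (single (f L)) P))
        (apply-μs L f (subT (extsN L (single (f L))) P))

μsCtx : ℕ → HCtx
μsCtx zero    = hole
μsCtx (suc L) = μc (μsCtx L)

applyCtx : HCtx → List Stack → HCtx
applyCtx C []       = C
applyCtx C (t ∷ ts) = applyCtx (C ⋆c t) ts

binderCtx : ℕ → (ℕ → Stack) → HCtx
binderCtx L f = applyCtx (μsCtx L) (map f (downFrom (suc L)))

plug-μsCtx : ∀ L P → plug (μsCtx L) (μ P) ≡ mus (suc L) P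
plug-μsCtx zero    P = refl
plug-μsCtx (suc L) P = cong μ (plug-μsCtx L P)

plug-applyCtx : ∀ C ts M → plug (applyCtx C ts) M ≡ plug C M ⋆⋆ ts
plug-applyCtx C []       M = refl
plug-applyCtx C (t ∷ ts) M = plug-applyCtx (C ⋆c t) ts M

plug-binderCtx : ∀ L f P → plug (binderCtx L f) (μ P) ≡ mus (suc L) P ⋆⋆ map f (downFrom (suc L))
plug-binderCtx L f P =
  trans (plug-applyCtx (μsCtx L) (map f (downFrom (suc L))) (μ P)) (cong (_⋆⋆ map f (downFrom (suc L))) (plug-μsCtx L P))

plug-⟶ : ∀ C {M M'} → M ⟶ₜ M' → plug C M ⟶ₜ plug C M'
plug-⟶ hole     st = st
plug-⟶ (C ⋆c π) st = ⋆-l (plug-⟶ C st)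
plug-⟶ (μc C)   st = μ-c (plug-⟶ C st)

tab : ℕ → (ℕ → Term) → Stack
tab zero    g = nil
tab (suc K) g = g 0 ∷ₛ tab K (g ∘ suc)

tab-closed : ∀ K g → (∀ i → ClosedT (g i)) → ClosedS (tab K g)
tab-closed zero    g closed = (λ σ → refl) , (λ ρ → refl)
tab-closed (suc K) g closed =
  (λ σ → cong₂ _∷ₛ_ (proj₁ (closed 0) σ) (proj₁ rest σ)) ,
  (λ ρ → cong₂ _∷ₛ_ (proj₂ (closed 0) ρ) (proj₂ rest ρ))
  where rest = tab-closed K (g ∘ suc) (closed ∘ suc)

tab-lookup : ∀ K g p → p < K → car (cdr^ p (tab K g)) ⟶* g p
tab-lookup (suc K) g zero    _         = car-β ◅ ε
tab-lookup (suc K) g (suc p) (s≤s p<K) rewrite cdr^-suc p (tab (suc K) g) =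
  car-c (cdr^-⟶ p cdr-β) ◅ tab-lookup K (g ∘ suc) p p<K

read-spine : ∀ r Ms k K g → r + k < K →
  car (cdr^ (r + length Ms) (Ms ++ₛ cdr^ k (tab K g))) ⟶* g (r + k)
read-spine r Ms k K g bound = begin
  car (cdr^ (r + length Ms) (Ms ++ₛ cdr^ k (tab K g)))
    ≡⟨ cong car (cdr^-+ r (length Ms) _) ⟩
  car (cdr^ r (cdr^ (length Ms) (Ms ++ₛ cdr^ k (tab K g))))
    ⟶*⟨ gmap (car ∘ cdr^ r) (car-c ∘ cdr^-⟶ r) (drop-prefix Ms _) ⟩
  car (cdr^ r (cdr^ k (tab K g)))
    ≡⟨ cong car (sym (cdr^-+ r k _)) ⟩
  car (cdr^ (r + k) (tab K g))
    ⟶*⟨ tab-lookup K g (r + k) bound ⟩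
  g (r + k) ∎
  where open StarReasoning _⟶ₜ_

yieldT yieldF : Term
yieldT = μ 𝐓
yieldF = μ 𝐅

readAt : ℕ → Term
readAt j = μ (carₙ j (var 0) ⋆ nil)

readAt-closed : ∀ j → ClosedT (readAt j)
readAt-closed j =
  (λ σ → cong (λ s → μ (car s ⋆ nil)) (cdr^-sub (exts σ) j (var 0))) ,
  (λ ρ → cong (λ s → μ (car s ⋆ nil)) (cdr^-ren (ext ρ) j (var 0)))

readAt-⟶ : ∀ j S → readAt j ⋆ S ⟶ₜ carₙ j S ⋆ nil
readAt-⟶ j S =
  subst (λ s → readAt j ⋆ S ⟶ₜ car s ⋆ nil) (cdr^-sub (single S) j (var 0)) μ-β

fire : ∀ {Y Z} S → Y ≡ μ Z → Y ⋆ S ⟶* Z [ S ]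
fire S refl = μ-β ◅ ε

override : ℕ → ℕ → Term → (ℕ → ℕ → Term) → ℕ → ℕ → Term
override x₀ i₀ u h x i with (x ≟ x₀) ×-dec (i ≟ i₀)
... | yes _ = u
... | no  _ = h x i

override-hit : ∀ x₀ i₀ u h → override x₀ i₀ u h x₀ i₀ ≡ u
override-hit x₀ i₀ u h with (x₀ ≟ x₀) ×-dec (i₀ ≟ i₀)
... | yes _  = refl
... | no  ne = ⊥-elim (ne (refl , refl))

override-miss : ∀ x₀ i₀ u h {x i} → ¬ (x ≡ x₀ × i ≡ i₀) → override x₀ i₀ u h x i ≡ h x i
override-miss x₀ i₀ u h {x} {i} ne with (x ≟ x₀) ×-dec (i ≟ i₀)
... | yes e = ⊥-elim (ne e)
... | no  _ = refl

override-closed : ∀ x₀ i₀ {u h} → ClosedT u → (∀ x i → ClosedT (h x i)) →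
  ∀ x i → ClosedT (override x₀ i₀ u h x i)
override-closed x₀ i₀ u-closed h-closed x i with (x ≟ x₀) ×-dec (i ≟ i₀)
... | yes _ = u-closed
... | no  _ = h-closed x i

constant-closed : ∀ {Y} → ClosedT Y → ∀ (x i : ℕ) → ClosedT Y
constant-closed Y-closed x i = Y-closed

yieldT-closed : ClosedT yieldT
yieldT-closed = (λ σ → refl) , (λ ρ → refl)

yieldF-closed : ClosedT yieldF
yieldF-closed = (λ σ → refl) , (λ ρ → refl)

module Separator (L K : ℕ) (g : ℕ → ℕ → Term) (g-closed : ∀ x i → ClosedT (g x i)) where

  table : ℕ → Stack
  table x = tab K (g x)

  table-closed : ∀ x → ClosedS (table x)
  table-closed x = tab-closed K (g x) (g-closed x)

  ctx : HCtx
  ctx = binderCtx L table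

  open StarReasoning _⟶ₜ_

  reach-head : ∀ n b π → b < suc L → n < K →
    plug ctx (μ (carₙ n (var b) ⋆ π)) ⟶* g b n ⋆ instS (suc L) table π
  reach-head n b π b≤L n<K = begin
    plug ctx (μ (carₙ n (var b) ⋆ π))
      ≡⟨ plug-binderCtx L table _ ⟩
    mus (suc L) (carₙ n (var b) ⋆ π) ⋆⋆ map table (downFrom (suc L))
      ⟶*⟨ apply-μs (suc L) table _ ⟩
    instT (suc L) table (carₙ n (var b) ⋆ π)
      ≡⟨ trans (inst-⋆ (suc L) table (carₙ n (var b)) π) (cong (_⋆ instS (suc L) table π) instantiated-head) ⟩
    carₙ n (table b) ⋆ instS (suc L) table π
      ⟶*⟨ gmap (_⋆ instS (suc L) table π) ⋆-l (tab-lookup K (g b) n n<K) ⟩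
    g b n ⋆ instS (suc L) table π ∎
    where
    instantiated-head : instT (suc L) table (carₙ n (var b)) ≡ carₙ n (table b)
    instantiated-head = trans (inst-car (suc L) table (cdr^ n (var b)))
      (cong car (trans (inst-cdr^ (suc L) table n (var b))
                       (cong (cdr^ n) (inst-var (suc L) table table-closed b b≤L))))

  read-through : ∀ n b {π} Ms k γ r j → b < suc L → n < K → γ < suc L → r + k < K →
    π ⟶ₛ* Ms ++ₛ cdr^ k (var γ) → j ≡ r + length Ms → g b n ≡ readAt j →
    plug ctx (μ (carₙ n (var b) ⋆ π)) ⟶* g γ (r + k) ⋆ nil
  read-through n b {π} Ms k γ r j b≤L n<K γ≤L bound red j≡ head-reads = begin
    plug ctx (μ (carₙ n (var b) ⋆ π))
      ⟶*⟨ gmap (plug ctx) (plug-⟶ ctx) (gmap (μ ∘ (carₙ n (var b) ⋆_)) (μ-c ∘ ⋆-r) red) ⟩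
    plug ctx (μ (carₙ n (var b) ⋆ shaped))
      ⟶*⟨ reach-head n b shaped b≤L n<K ⟩
    g b n ⋆ instS (suc L) table shaped
      ≡⟨ cong₂ _⋆_ head-reads instantiated-spine ⟩
    readAt j ⋆ (Ms' ++ₛ cdr^ k (table γ))
      ⟶⟨ readAt-⟶ j _ ⟩
    carₙ j (Ms' ++ₛ cdr^ k (table γ)) ⋆ nil
      ≡⟨ cong (λ i → carₙ i (Ms' ++ₛ cdr^ k (table γ)) ⋆ nil)
              (trans j≡ (cong (r +_) (sym (length-map _ Ms)))) ⟩
    carₙ (r + length Ms') (Ms' ++ₛ cdr^ k (table γ)) ⋆ nil
      ⟶*⟨ gmap (_⋆ nil) ⋆-l (read-spine r Ms' k K (g γ) bound) ⟩
    g γ (r + k) ⋆ nil ∎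
    where
    shaped : Stack
    shaped = Ms ++ₛ cdr^ k (var γ)

    Ms' : List Term
    Ms' = map (instT (suc L) table) Ms

    instantiated-spine : instS (suc L) table shaped ≡ Ms' ++ₛ cdr^ k (table γ)
    instantiated-spine = trans (inst-++ₛ (suc L) table Ms _)
      (cong (Ms' ++ₛ_) (trans (inst-cdr^ (suc L) table k (var γ))
        (cong (cdr^ k) (inst-var (suc L) table table-closed γ γ≤L))))

headCase : ∀ n b π n' b' π' → ¬ (b ≡ b' × n ≡ n') →
  Separable (μ (carₙ n (var b) ⋆ π)) (μ (carₙ n' (var b') ⋆ π'))
headCase n b π n' b' π' differ =
  ctx ,
  ⟶*⇒=ₜ (reach-head n b π (s≤s (m≤m+n b b')) (s≤s (m≤m+n n n'))
           ◅◅ fire _ (override-miss b' n' yieldF (λ _ _ → yieldT) differ)) ,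
  ⟶*⇒=ₜ (reach-head n' b' π' (s≤s (m≤n+m b' b)) (s≤s (m≤n+m n' n))
           ◅◅ fire _ (override-hit b' n' yieldF (λ _ _ → yieldT)))
  where
  open Separator (b + b') (suc (n + n')) (override b' n' yieldF (λ _ _ → yieldT))
    (override-closed b' n' yieldF-closed (constant-closed yieldT-closed))

-- The reader looks at depth
-- j = r + m = r' + m', where r = 1 + n + m' and r' = 1 + n + m, so the
-- two sides land at entries (γ , r + k) and (γ' , r' + k'), both beyond n.

reading-depths : ∀ s m m' → (s + m') + m ≡ (s + m) + m'
reading-depths s m m' =
  trans (+-assoc s m' m) (trans (cong (s +_) (+-comm m' m)) (sym (+-assoc s m m')))

-- Equal landing entries force the spines to be balanced.
landing-balanced : ∀ s m m' k k' → (s + m) + k' ≡ (s + m') + k → k + m' ≡ k' + m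
landing-balanced s m m' k k' same = begin
  k + m'  ≡⟨ +-comm k m' ⟩
  m' + k  ≡⟨ +-cancelˡ-≡ s _ _ (trans (sym (+-assoc s m' k)) (trans (sym same) (+-assoc s m k'))) ⟩
  m + k'  ≡⟨ +-comm m k' ⟩
  k' + m  ∎
  where open ≡-Reasoning

module SpineCase (n b : ℕ) {π π' : Stack} (Ms Ns : List Term) (k k' γ γ' : ℕ)
    (red : π ⟶ₛ* Ms ++ₛ cdr^ k (var γ)) (red' : π' ⟶ₛ* Ns ++ₛ cdr^ k' (var γ'))
    (unbalanced : ¬ (γ ≡ γ' × k + length Ns ≡ k' + length Ms)) where

  m m' r r' j p p' : ℕ
  m  = length Ms
  m' = length Ns
  r  = suc n + m'
  r' = suc n + m
  j  = r + m
  p  = r + k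
  p' = r' + k'

  n<p : n < p
  n<p = s≤s (≤-trans (m≤m+n n m') (m≤m+n _ k))

  n<p' : n < p'
  n<p' = s≤s (≤-trans (m≤m+n n m) (m≤m+n _ k'))

  allF rest g : ℕ → ℕ → Term
  allF _ _ = yieldF
  rest = override γ p yieldT allF
  g    = override b n (readAt j) rest

  g-closed : ∀ x i → ClosedT (g x i)
  g-closed = override-closed b n (readAt-closed j)
               (override-closed γ p yieldT-closed (constant-closed yieldF-closed))

  L K : ℕ
  L = b + (γ + γ')
  K = suc (p + p')

  b<1+L : b < suc L
  b<1+L = s≤s (m≤m+n b _)

  γ<1+L : γ < suc L
  γ<1+L = s≤s (≤-trans (m≤m+n γ γ') (m≤n+m _ b))

  γ'<1+L : γ' < suc L
  γ'<1+L = s≤s (≤-trans (m≤n+m γ' γ) (m≤n+m _ b))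

  p<K : p < K
  p<K = s≤s (m≤m+n p p')

  p'<K : p' < K
  p'<K = s≤s (m≤n+m p' p)

  n<K : n < K
  n<K = <-trans n<p p<K

  open Separator L K g g-closed

  left-reads-𝐓 : g γ p ≡ yieldT
  left-reads-𝐓 = trans (override-miss b n (readAt j) rest {x = γ} (λ (_ , p≡n) → >⇒≢ n<p p≡n))
                       (override-hit γ p yieldT allF)

  right-reads-𝐅 : g γ' p' ≡ yieldF
  right-reads-𝐅 = trans (override-miss b n (readAt j) rest {x = γ'} (λ (_ , p'≡n) → >⇒≢ n<p' p'≡n))
                        (override-miss γ p yieldT allF landing-differs)
    where
    landing-differs : ¬ (γ' ≡ γ × p' ≡ p)
    landing-differs (γ'≡γ , p'≡p) =
      unbalanced (sym γ'≡γ , landing-balanced (suc n) m m' k k' p'≡p)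

  separable : Separable (μ (carₙ n (var b) ⋆ π)) (μ (carₙ n (var b) ⋆ π'))
  separable =
    ctx ,
    ⟶*⇒=ₜ (read-through n b Ms k γ r j b<1+L n<K γ<1+L p<K red refl head-reads
           ◅◅ fire nil left-reads-𝐓) ,
    ⟶*⇒=ₜ (read-through n b Ns k' γ' r' j b<1+L n<K γ'<1+L p'<K red' (reading-depths (suc n) m m')
             head-reads
           ◅◅ fire nil right-reads-𝐅)
    where
    head-reads : g b n ≡ readAt j
    head-reads = override-hit b n (readAt j) rest

-- Equal heads: dissimilar argument stacks have variable tails that are
-- not balanced, so Case 2 applies.
sameHeadCase : ∀ n b π π' → ¬ (μ (carₙ n (var b) ⋆ π) ∼ μ (carₙ n (var b) ⋆ π')) →
  Separable (μ (carₙ n (var b) ⋆ π)) (μ (carₙ n (var b) ⋆ π'))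
sameHeadCase n b π π' dissimilar with spineForm π | spineForm π'
... | spine Ms k nil-tail red | _ =
  ⊥-elim (dissimilar (head∼ n b (nil-spine∼ₛ {Ms = Ms} {k} red π')))
... | _ | spine Ns k' nil-tail red' =
  ⊥-elim (dissimilar (head∼ n b (symmetric StackSimGen (nil-spine∼ₛ {Ms = Ns} {k'} red' π))))
... | spine Ms k (var-tail γ) red | spine Ns k' (var-tail γ') red'
    with (γ ≟ γ') ×-dec (k + length Ns ≟ k' + length Ms)
...   | yes (refl , balanced) = ⊥-elim (dissimilar (head∼ n b (var-spine∼ₛ {Ms = Ms} {Ns} {k} {k'} red red' balanced)))
...   | no unbalanced = SpineCase.separable n b Ms Ns k k' γ γ' red red' unbalanced

theorem7 : ∀ (n b : ℕ) (π : Stack) (n' b' : ℕ) (π' : Stack) →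
    ¬ (μ (carₙ n (var b) ⋆ π) ∼ μ (carₙ n' (var b') ⋆ π')) →
    Separable (μ (carₙ n (var b) ⋆ π)) (μ (carₙ n' (var b') ⋆ π'))
theorem7 n b π n' b' π' dissimilar with (b ≟ b') ×-dec (n ≟ n')
... | yes (refl , refl) = sameHeadCase n b π π' dissimilar
... | no differ         = headCase n b π n' b' π' differ
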